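{- Let $\mathcal{G}$ be a family of undirected graphs, closed under edge-deletion and with bounded chromatic number, and let $k$ be an integer with $k\geq\chi(G)$ for every $G\in\mathcal{G}$, such that for every $n$-vertex graph $G\in\mathcal{G}$ the diameter of $\mathcal{C}_k(G)$ is at most $f(n)$, for some function $f$. Then for any $n$-vertex digraph $D$ whose underlying graph $\operatorname{UG}(D)$ belongs to $\mathcal{G}$, the diameter of $\mathcal{D}_k(D)$ is at most $2f(n)$.
   Context: $\mathcal{C}_k(G)$ is the graph whose vertices are the proper $k$-colourings of $G$, two adjacent iff they differ on the colour of exactly one vertex. $\operatorname{UG}(D)$ is the undirected graph on $V(D)$ with $uv$ an edge iff $uv$ or $vu$ is an arc of $D$. A $k$-dicolouring of $D$ is a map $V(D)\to[k]$ whose colour classes induce acyclic subdigraphs; $\mathcal{D}_k(D)$ is the graph on $k$-dicolourings of $D$, two adjacent iff they differ on exactly one vertex. -}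

module Defs where

open import Data.Nat using (ℕ; zero; suc; _≤_)
open import Data.Fin using (Fin; zero; suc; inject₁; fromℕ; _≟_)
open import Data.Bool using (Bool; true; false; _∧_; _∨_; not; T)
open import Data.Bool.Properties using (∨-comm)
open import Data.Product using (Σ; ∃; _×_; _,_)
open import Data.Empty using (⊥)
open import Relation.Nullary using (¬_; does)
open import Relation.Binary.PropositionalEquality using (_≡_; _≢_; refl; trans; cong; cong₂)
open import Function.Definitions using (Injective)

record Graph (n : ℕ) : Set where
  field
    adj   : Fin n → Fin n → Bool
    adj-sym : ∀ x y → adj x y ≡ adj y x
    irrfl : ∀ x → adj x x ≡ false
open Graph public

samePair : ∀ {n} → Fin n → Fin n → Fin n → Fin n → Bool
samePair u v x y = (does (x ≟ u) ∧ does (y ≟ v)) ∨ (does (x ≟ v) ∧ does (y ≟ u))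

private
  ∧-comm' : ∀ a b → (a ∧ b) ≡ (b ∧ a)
  ∧-comm' false false = refl
  ∧-comm' false true  = refl
  ∧-comm' true  false = refl
  ∧-comm' true  true  = refl

  samePair-sym : ∀ {n} (u v x y : Fin n) → samePair u v x y ≡ samePair u v y x
  samePair-sym u v x y =
    trans (∨-comm (does (x ≟ u) ∧ does (y ≟ v)) (does (x ≟ v) ∧ does (y ≟ u)))
          (cong₂ _∨_ (∧-comm' (does (x ≟ v)) (does (y ≟ u)))
                     (∧-comm' (does (x ≟ u)) (does (y ≟ v))))

  ∧-false : ∀ a b → a ≡ false → (a ∧ b) ≡ false
  ∧-false .false b refl = refl

deleteEdge : ∀ {n} → Graph n → Fin n → Fin n → Graph n
deleteEdge G u v = record
  { adj   = λ x y → adj G x y ∧ not (samePair u v x y)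
  ; adj-sym = λ x y → cong₂ _∧_ (adj-sym G x y) (cong not (samePair-sym u v x y))
  ; irrfl = λ x → ∧-false (adj G x x) _ (irrfl G x)
  }

Family : Set₁
Family = (n : ℕ) → Graph n → Set

ClosedUnderEdgeDeletion : Family → Set
ClosedUnderEdgeDeletion 𝒢 = ∀ n (G : Graph n) (u v : Fin n) → 𝒢 n G → 𝒢 n (deleteEdge G u v)

Colouring : ℕ → ℕ → Set
Colouring n k = Fin n → Fin k

Proper : ∀ {n k} → Graph n → Colouring n k → Set
Proper G α = ∀ x y → T (adj G x y) → α x ≢ α y

ChromaticAtMost : ∀ {n} → Graph n → ℕ → Set
ChromaticAtMost {n} G k = Σ (Colouring n k) (Proper G)

DifferOnOne : ∀ {n k} → Colouring n k → Colouring n k → Set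
DifferOnOne α β = ∃ λ v → (α v ≢ β v) × (∀ u → u ≢ v → α u ≡ β u)

-- Walk P m α β : a walk of length m from α to β in the reconfiguration
-- graph whose vertices are the colourings satisfying P
data Walk {n k : ℕ} (P : Colouring n k → Set) :
          ℕ → Colouring n k → Colouring n k → Set where
  nil  : ∀ {α} → Walk P zero α α
  cons : ∀ {m α β γ} → DifferOnOne α β → P β → Walk P m β γ → Walk P (suc m) α γ

DiameterAtMost : ∀ {n k} → (Colouring n k → Set) → ℕ → Set
DiameterAtMost {n} {k} P d =
  ∀ (α β : Colouring n k) → P α → P β → ∃ λ m → (m ≤ d) × Walk P m α β

𝒞 : ∀ {n} (k : ℕ) → Graph n → Colouring n k → Set
𝒞 k G = Proper G

-- Digraphs (loopless; digons allowed)

record Digraph (n : ℕ) : Set where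
  field
    arc      : Fin n → Fin n → Bool
    loopless : ∀ x → arc x x ≡ false
open Digraph public

private
  ∨-false : ∀ a b → a ≡ false → b ≡ false → (a ∨ b) ≡ false
  ∨-false .false .false refl refl = refl

UG : ∀ {n} → Digraph n → Graph n
UG D = record
  { adj   = λ x y → arc D x y ∨ arc D y x
  ; adj-sym = λ x y → ∨-comm (arc D x y) (arc D y x)
  ; irrfl = λ x → ∨-false _ _ (loopless D x) (loopless D x)
  }

DirectedCycleIn : ∀ {n} → Digraph n → (Fin n → Set) → Set
DirectedCycleIn {n} D S =
  ∃ λ m → Σ (Fin (suc m) → Fin n) λ c →
      Injective _≡_ _≡_ c
    × (∀ (i : Fin m) → T (arc D (c (inject₁ i)) (c (suc i))))
    × T (arc D (c (fromℕ m)) (c zero))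
    × (∀ i → S (c i))

InducesAcyclic : ∀ {n} → Digraph n → (Fin n → Set) → Set
InducesAcyclic D S = ¬ DirectedCycleIn D S

Dicolouring : ∀ {n k} → Digraph n → Colouring n k → Set
Dicolouring {n} {k} D α = ∀ (c : Fin k) → InducesAcyclic D (λ v → α v ≡ c)

𝒟 : ∀ {n} (k : ℕ) → Digraph n → Colouring n k → Set
𝒟 k D = Dicolouring D

-- Given a dicolouring α of D, delete from UG(D) every edge that α makes
-- monochromatic. The resulting graph G_α lies in 𝒢, α is a proper colouring of it,
-- and every proper colouring β of G_α is a dicolouring of D: a β-monochromatic
-- directed cycle uses only deleted edges, so it would be α-monochromatic too.
-- Hence 𝒞_k(G_α) embeds into 𝒟_k(D), and α reaches a fixed proper k-colouring γ
-- of UG(D) (proper for every G_α) within f(n) steps. Two such walks, α → γ and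
-- β → γ, give a walk α → β of length at most 2 f(n).
module Submission where

open import Defs
open import Level using (0ℓ)
open import Data.Nat using (ℕ; _*_; _+_; _≤_; zero; suc)
open import Data.Nat.Properties using (+-mono-≤; m≤n⇒m≤n+o)
open import Data.Fin using (Fin; zero; suc; inject₁; _≟_)
open import Data.Bool using (true; false; T)
open import Data.Bool.Properties using (T-∧; T-∨)
open import Data.Unit using (tt)
open import Data.Empty using (⊥-elim)
open import Data.Product using (∃; _×_; _,_; proj₁; proj₂)
open import Data.Sum using (_⊎_; inj₁; inj₂; [_,_])
open import Data.List using (List; []; _∷_; allFin; cartesianProduct)
open import Data.List.Membership.Propositional using (_∈_)
open import Data.List.Relation.Unary.Any using (here; there)
open import Data.List.Membership.Propositional.Properties using (∈-cartesianProduct⁺; ∈-allFin)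
open import Function.Base using (id)
open import Function.Bundles using (Equivalence)
open import Relation.Nullary using (¬_; yes; no)
open import Relation.Binary using (Rel; Decidable)
open import Relation.Binary.PropositionalEquality using (_≡_; refl; sym; trans; subst)

open Equivalence using (to; from)

module _ {n k : ℕ} {P : Colouring n k → Set} where

  differOnOne-sym : ∀ {α β : Colouring n k} → DifferOnOne α β → DifferOnOne β α
  differOnOne-sym (v , αv≢βv , agree) = v , (λ e → αv≢βv (sym e)) , (λ u u≢v → sym (agree u u≢v))

  snocWalk : ∀ {m α β γ} → Walk P m α β → DifferOnOne β γ → P γ → Walk P (suc m) α γ
  snocWalk nil           d Pγ = cons d Pγ nil
  snocWalk (cons d′ Pβ w) d Pγ = cons d′ Pβ (snocWalk w d Pγ)

  reverseWalk : ∀ {m α β} → P α → Walk P m α β → Walk P m β α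
  reverseWalk Pα nil           = nil
  reverseWalk Pα (cons d Pβ w) = snocWalk (reverseWalk Pβ w) (differOnOne-sym d) Pα

  _++ʷ_ : ∀ {m m′ α β γ} → Walk P m α β → Walk P m′ β γ → Walk P (m + m′) α γ
  nil         ++ʷ w′ = w′
  cons d Pβ w ++ʷ w′ = cons d Pβ (w ++ʷ w′)

  diameter-via-centre : ∀ (γ : Colouring n k) d →
    (∀ α → P α → ∃ λ m → m ≤ d × Walk P m α γ) → DiameterAtMost P (2 * d)
  diameter-via-centre γ d reach α β Pα Pβ with reach α Pα | reach β Pβ
  ... | m , m≤d , wα | m′ , m′≤d , wβ =
    m + m′ , +-mono-≤ m≤d (m≤n⇒m≤n+o 0 m′≤d) , wα ++ʷ reverseWalk Pβ wβ

mapWalk : ∀ {n k} {P Q : Colouring n k → Set} → (∀ γ → P γ → Q γ) →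
          ∀ {m α β} → Walk P m α β → Walk Q m α β
mapWalk P⇒Q nil           = nil
mapWalk P⇒Q (cons d Pβ w) = cons d (P⇒Q _ Pβ) (mapWalk P⇒Q w)

Subgraph : ∀ {n} → Graph n → Graph n → Set
Subgraph {n} H G = ∀ (x y : Fin n) → T (adj H x y) → T (adj G x y)

proper-subgraph : ∀ {n k} {H G : Graph n} {γ : Colouring n k} →
                  Subgraph H G → Proper G γ → Proper H γ
proper-subgraph H⊆G γ-proper x y xy∈H = γ-proper x y (H⊆G x y xy∈H)

module _ {n : ℕ} where

  samePair-sound : ∀ (u v x y : Fin n) → T (samePair u v x y) →
                   (x ≡ u × y ≡ v) ⊎ (x ≡ v × y ≡ u)
  samePair-sound u v x y t with x ≟ u | y ≟ v | x ≟ v | y ≟ u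
  ... | yes x≡u | yes y≡v | _       | _       = inj₁ (x≡u , y≡v)
  ... | yes _   | no _    | yes x≡v | yes y≡u = inj₂ (x≡v , y≡u)
  ... | no _    | _       | yes x≡v | yes y≡u = inj₂ (x≡v , y≡u)

  samePair-refl : ∀ (u v : Fin n) → T (samePair u v u v)
  samePair-refl u v with u ≟ u | v ≟ v
  ... | yes _  | yes _  = tt
  ... | no u≢u | _      = ⊥-elim (u≢u refl)
  ... | yes _  | no v≢v = ⊥-elim (v≢v refl)

  deleteEdge-⊆ : ∀ (G : Graph n) u v → Subgraph (deleteEdge G u v) G
  deleteEdge-⊆ G u v x y t = proj₁ (to (T-∧ {adj G x y}) t)

  deleteEdge-removes : ∀ (G : Graph n) u v → ¬ T (adj (deleteEdge G u v) u v)
  deleteEdge-removes G u v t with samePair u v u v | samePair-refl u v | proj₂ (to (T-∧ {adj G u v}) t)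
  ... | true | _ | ()

  deleteEdge-lost : ∀ (G : Graph n) u v x y → T (adj G x y) →
                    ¬ T (adj (deleteEdge G u v) x y) → T (samePair u v x y)
  deleteEdge-lost G u v x y xy∈G xy∉G′ with samePair u v x y
  ... | true  = tt
  ... | false = ⊥-elim (xy∉G′ (from T-∧ (xy∈G , tt)))

module _ {n : ℕ} {R : Rel (Fin n) 0ℓ} (R? : Decidable R) where

  deleteEdgeIf : Graph n → Fin n → Fin n → Graph n
  deleteEdgeIf G u v with R? u v
  ... | yes _ = deleteEdge G u v
  ... | no  _ = G

  deleteEdgesIf : Graph n → List (Fin n × Fin n) → Graph n
  deleteEdgesIf G []            = G
  deleteEdgesIf G ((u , v) ∷ L) = deleteEdgesIf (deleteEdgeIf G u v) L

  deleteEdgeIf-⊆ : ∀ G u v → Subgraph (deleteEdgeIf G u v) G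
  deleteEdgeIf-⊆ G u v with R? u v
  ... | yes _ = deleteEdge-⊆ G u v
  ... | no  _ = λ _ _ t → t

  deleteEdgeIf-lost : ∀ G u v x y → T (adj G x y) →
                      ¬ T (adj (deleteEdgeIf G u v) x y) → R x y ⊎ R y x
  deleteEdgeIf-lost G u v x y xy∈G xy∉G′ with R? u v
  ... | no _    = ⊥-elim (xy∉G′ xy∈G)
  ... | yes Ruv with samePair-sound u v x y (deleteEdge-lost G u v x y xy∈G xy∉G′)
  ...   | inj₁ (refl , refl) = inj₁ Ruv
  ...   | inj₂ (refl , refl) = inj₂ Ruv

  deleteEdgeIf-removes : ∀ G u v → R u v → ¬ T (adj (deleteEdgeIf G u v) u v)
  deleteEdgeIf-removes G u v Ruv with R? u v
  ... | yes _    = deleteEdge-removes G u v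
  ... | no ¬Ruv  = ⊥-elim (¬Ruv Ruv)

  deleteEdgeIf-closed : ∀ (𝒢 : Family) → ClosedUnderEdgeDeletion 𝒢 →
                        ∀ G u v → 𝒢 n G → 𝒢 n (deleteEdgeIf G u v)
  deleteEdgeIf-closed 𝒢 closed G u v G∈𝒢 with R? u v
  ... | yes _ = closed n G u v G∈𝒢
  ... | no  _ = G∈𝒢

  deleteEdgesIf-⊆ : ∀ G L → Subgraph (deleteEdgesIf G L) G
  deleteEdgesIf-⊆ G []            x y t = t
  deleteEdgesIf-⊆ G ((u , v) ∷ L) x y t =
    deleteEdgeIf-⊆ G u v x y (deleteEdgesIf-⊆ (deleteEdgeIf G u v) L x y t)

  deleteEdgesIf-lost : ∀ G L x y → T (adj G x y) →
                       ¬ T (adj (deleteEdgesIf G L) x y) → R x y ⊎ R y x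
  deleteEdgesIf-lost G []            x y xy∈G xy∉G′ = ⊥-elim (xy∉G′ xy∈G)
  deleteEdgesIf-lost G ((u , v) ∷ L) x y xy∈G xy∉G′ with adj (deleteEdgeIf G u v) x y in eq
  ... | true  = deleteEdgesIf-lost (deleteEdgeIf G u v) L x y (subst T (sym eq) tt) xy∉G′
  ... | false = deleteEdgeIf-lost G u v x y xy∈G (subst T eq)

  deleteEdgesIf-removes : ∀ G L x y → (x , y) ∈ L → R x y →
                          ¬ T (adj (deleteEdgesIf G L) x y)
  deleteEdgesIf-removes G ((u , v) ∷ L) x y (here refl) Rxy t =
    deleteEdgeIf-removes G x y Rxy (deleteEdgesIf-⊆ (deleteEdgeIf G x y) L x y t)
  deleteEdgesIf-removes G ((u , v) ∷ L) x y (there xy∈L) Rxy t =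
    deleteEdgesIf-removes (deleteEdgeIf G u v) L x y xy∈L Rxy t

  deleteEdgesIf-closed : ∀ (𝒢 : Family) → ClosedUnderEdgeDeletion 𝒢 →
                         ∀ G L → 𝒢 n G → 𝒢 n (deleteEdgesIf G L)
  deleteEdgesIf-closed 𝒢 closed G []            G∈𝒢 = G∈𝒢
  deleteEdgesIf-closed 𝒢 closed G ((u , v) ∷ L) G∈𝒢 =
    deleteEdgesIf-closed 𝒢 closed (deleteEdgeIf G u v) L (deleteEdgeIf-closed 𝒢 closed G u v G∈𝒢)

module _ {n k : ℕ} (α : Colouring n k) where

  private
    sameColour? : Decidable (λ u v → α u ≡ α v)
    sameColour? u v = α u ≟ α v

    allPairs : List (Fin n × Fin n)
    allPairs = cartesianProduct (allFin n) (allFin n)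

  deleteMonochromatic : Graph n → Graph n
  deleteMonochromatic G = deleteEdgesIf sameColour? G allPairs

  deleteMonochromatic-⊆ : ∀ G → Subgraph (deleteMonochromatic G) G
  deleteMonochromatic-⊆ G = deleteEdgesIf-⊆ sameColour? G allPairs

  deleteMonochromatic-proper : ∀ G → Proper (deleteMonochromatic G) α
  deleteMonochromatic-proper G x y xy∈G αx≡αy =
    deleteEdgesIf-removes sameColour? G allPairs x y
      (∈-cartesianProduct⁺ (∈-allFin x) (∈-allFin y)) αx≡αy xy∈G

  deleteMonochromatic-lost : ∀ G x y → T (adj G x y) →
                             ¬ T (adj (deleteMonochromatic G) x y) → α x ≡ α y
  deleteMonochromatic-lost G x y xy∈G xy∉G′ =
    [ id , sym ] (deleteEdgesIf-lost sameColour? G allPairs x y xy∈G xy∉G′)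

  deleteMonochromatic-closed : ∀ (𝒢 : Family) → ClosedUnderEdgeDeletion 𝒢 →
                               ∀ G → 𝒢 n G → 𝒢 n (deleteMonochromatic G)
  deleteMonochromatic-closed 𝒢 closed G = deleteEdgesIf-closed sameColour? 𝒢 closed G allPairs

constant-along-path : ∀ {A : Set} m (g : Fin (suc m) → A) →
                      (∀ (i : Fin m) → g (inject₁ i) ≡ g (suc i)) → ∀ j → g j ≡ g zero
constant-along-path m       g steps zero    = refl
constant-along-path (suc m) g steps (suc i) =
  trans (sym (steps i)) (constant-along-path m (λ j → g (inject₁ j)) (λ j → steps (inject₁ j)) i)

proper-deleteMonochromatic⇒dicolouring :
  ∀ {n k} (D : Digraph n) {α β : Colouring n k} → Dicolouring D α →
  Proper (deleteMonochromatic α (UG D)) β → Dicolouring D β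
proper-deleteMonochromatic⇒dicolouring D {α} {β} α-dicol β-proper _
  (m , cyc , injective , arcs , closing , β≡c) =
  α-dicol (α (cyc zero))
    (m , cyc , injective , arcs , closing , constant-along-path m (λ j → α (cyc j)) α-step)
  where
  α-step : ∀ i → α (cyc (inject₁ i)) ≡ α (cyc (suc i))
  α-step i = deleteMonochromatic-lost α (UG D) _ _
    (from T-∨ (inj₁ (arcs i)))
    (λ t → β-proper _ _ t (trans (β≡c (inject₁ i)) (sym (β≡c (suc i)))))

walk-to-proper-colouring :
  ∀ (𝒢 : Family) → ClosedUnderEdgeDeletion 𝒢 → ∀ k (f : ℕ → ℕ) →
  (∀ n (G : Graph n) → 𝒢 n G → DiameterAtMost (𝒞 k G) (f n)) →
  ∀ n (D : Digraph n) → 𝒢 n (UG D) → (γ : Colouring n k) → Proper (UG D) γ →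
  ∀ α → Dicolouring D α → ∃ λ m → m ≤ f n × Walk (𝒟 k D) m α γ
walk-to-proper-colouring 𝒢 closed k f diam n D UG∈𝒢 γ γ-proper α α-dicol =
  let m , m≤fn , w = diam n G_α (deleteMonochromatic-closed α 𝒢 closed (UG D) UG∈𝒢) α γ
                       (deleteMonochromatic-proper α (UG D))
                       (proper-subgraph {H = G_α} {G = UG D} (deleteMonochromatic-⊆ α (UG D)) γ-proper)
  in m , m≤fn , mapWalk (λ _ → proper-deleteMonochromatic⇒dicolouring D α-dicol) w
  where
  G_α : Graph n
  G_α = deleteMonochromatic α (UG D)

theorem17 : (𝒢 : Family) → ClosedUnderEdgeDeletion 𝒢
    → (k : ℕ) → (∀ n (G : Graph n) → 𝒢 n G → ChromaticAtMost G k)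
    → (f : ℕ → ℕ) → (∀ n (G : Graph n) → 𝒢 n G → DiameterAtMost (𝒞 k G) (f n))
    → ∀ n (D : Digraph n) → 𝒢 n (UG D) → DiameterAtMost (𝒟 k D) (2 * f n)
theorem17 𝒢 closed k χ≤k f diam n D UG∈𝒢 =
  diameter-via-centre γ (f n) (walk-to-proper-colouring 𝒢 closed k f diam n D UG∈𝒢 γ γ-proper)
  where
  γ : Colouring n k
  γ = proj₁ (χ≤k n (UG D) UG∈𝒢)
  γ-proper : Proper (UG D) γ
  γ-proper = proj₂ (χ≤k n (UG D) UG∈𝒢)
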